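{- Let $(\vec{E},f)$ be a nowhere-zero $6$-flow and $D=(V,(\vec{E})^{ -1})$ be a digraph with costs $c'(e)=c(e)(3-f(e))$ for all $e\in(\vec{E})^{ -1}$ and capacities $l=0,u=1$. Then, $g:(\vec{E})^{ -1}\rightarrow \mathbb{Z}$ is a min cost circulation if and only if $f+6g$ is a locally optimal nowhere-zero $6$-flow.
   Context: Let $G=(V,E)$ be an undirected graph with bidirected graph $\vec{G}=(V,E^+\cup E^-)$ (two opposite copies $e^+,e^-$ of each edge $e$), and let $c:E^+\cup E^-\to\mathbb{Z}_{\ge 0}$ be symmetric costs, i.e. $c(e^+)=c(e^-)$ for every $e\in E$. For an arc $e$, $e^{ -1}$ denotes its reverse, and for an orientation $\vec{E}$, $(\vec{E})^{ -1}$ denotes the set of reversed arcs. A nowhere-zero $k$-flow is a pair $(\vec{E},f)$ with $\vec{E}$ an orientation of $E$ and $f:\vec{E}\to\{1,\dots,k-1\}$ satisfying flow conservation at every vertex; it is extended to all of $E^+\cup E^-$ by $f(e^{ -1}):=-f(e)$ for $e\in\vec{E}$ (and $0$ on unoriented edges), and sums such as $f+6g$ are defined as sums of these extensions (with $g$ on $(\vec{E})^{ -1}$ likewise extended by $g(e):=-g(e^{ -1})$ for $e\in\vec{E}$); the orientation associated with a flow is the set of arcs where its value is positive. A nowhere-zero $6$-flow $(\vec{E},f)$ is called locally optimal if for every directed cycle $C\subseteq\vec{E}$ (w.r.t. the flow's orientation) one has $\sum_{e\in C}c(e)f(e)\le 3\sum_{e\in C}c(e)$. A circulation $g$ on $D$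 is an integral function satisfying flow conservation at every vertex and $l(e)\le g(e)\le u(e)$ on every arc; a min cost circulation minimizes $\sum_{e}c'(e)g(e)$. -}

module Defs where

open import Data.Nat as ℕ using (ℕ)
open import Data.Integer as ℤ using (ℤ; +_; -_; _+_; _*_; _-_)
open import Data.Fin using (Fin)
open import Data.Fin.Properties using () renaming (_≟_ to _≟ᶠ_)
open import Data.List using (List; []; _∷_; _∷ʳ_; map; foldr; allFin)
open import Data.List.Relation.Unary.Linked using (Linked)
open import Data.List.Relation.Unary.Unique.Propositional using (Unique)
open import Data.Empty using (⊥)
open import Data.Bool using (Bool; true; false; if_then_else_)
open import Data.Product using (_×_; Σ; ∃; _,_)
open import Relation.Binary.PropositionalEquality using (_≡_)
open import Relation.Nullary.Decidable using (⌊_⌋)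

-- Undirected (multi)graph G = (V,E): V = Fin n, E = Fin m, each edge e has
-- a fixed reference direction src e → tgt e; the arc e⁺ is src e → tgt e
-- and the arc e⁻ is tgt e → src e.  Symmetric costs c(e⁺)=c(e⁻) are given
-- as a single function c : Fin m → ℕ on edges.

Σℤ : ∀ {m} → (Fin m → ℤ) → ℤ
Σℤ {m} w = foldr (λ e acc → w e + acc) (+ 0) (allFin m)

Σℕ : ∀ {m} → (Fin m → ℕ) → ℕ
Σℕ {m} w = foldr (λ e acc → w e ℕ.+ acc) 0 (allFin m)

[_≡_]ℤ : ∀ {n} → Fin n → Fin n → ℤ
[ a ≡ b ]ℤ = if ⌊ a ≟ᶠ b ⌋ then + 1 else + 0

Conserves : ∀ {n k} → (tl hd : Fin k → Fin n) → (Fin k → ℤ) → Set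
Conserves {n} tl hd w =
  ∀ (v : Fin n) → Σℤ (λ a → [ hd a ≡ v ]ℤ * w a) ≡ Σℤ (λ a → [ tl a ≡ v ]ℤ * w a)

-- An orientation E⃗ of E: for each edge, true = e⁺ ∈ E⃗, false = e⁻ ∈ E⃗.
Orientation : ℕ → Set
Orientation m = Fin m → Bool

tailO : ∀ {n m} → (Fin m → Fin n) → (Fin m → Fin n) → Orientation m → Fin m → Fin n
tailO src tgt d e = if d e then src e else tgt e

headO : ∀ {n m} → (Fin m → Fin n) → (Fin m → Fin n) → Orientation m → Fin m → Fin n
headO src tgt d e = if d e then tgt e else src e

-- (E⃗, f) is a nowhere-zero k-flow: f : E⃗ → {1,…,k-1} with conservation.
-- f e is the value on the arc of E⃗ belonging to edge e.
IsNZFlow : ∀ {n m} → (src tgt : Fin m → Fin n) → ℕ → Orientation m → (Fin m → ℕ) → Set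
IsNZFlow src tgt k d f =
  (∀ e → (1 ℕ.≤ f e) × (f e ℕ.≤ k ℕ.∸ 1))
  × Conserves (tailO src tgt d) (headO src tgt d) (λ e → + f e)

-- Extension of a flow (E⃗,f) to E⁺ ∪ E⁻ (f(e⁻¹) = -f(e)), recorded by its
-- value on the arc e⁺.
extF : ∀ {m} → Orientation m → (Fin m → ℕ) → Fin m → ℤ
extF d f e = if d e then + f e else - (+ f e)

-- Extension of g : (E⃗)⁻¹ → ℤ to E⁺ ∪ E⁻ (g(e) = -g(e⁻¹) for e ∈ E⃗),
-- recorded by its value on the arc e⁺.  g e is the value on the reverse of
-- the E⃗-arc of edge e.
extR : ∀ {m} → Orientation m → (Fin m → ℤ) → Fin m → ℤ
extR d g e = if d e then - g e else g e

-- Directed cycle in the digraph (Fin n, arcs tl/hd): a nonempty list of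
-- arcs e₁ … e_k with hd eᵢ = tl eᵢ₊₁ and hd e_k = tl e₁, whose tails are
-- pairwise distinct (so the vertices, hence the arcs, are distinct).
IsDirCycle : ∀ {n m} → (tl hd : Fin m → Fin n) → List (Fin m) → Set
IsDirCycle tl hd [] = ⊥
IsDirCycle tl hd (e ∷ es) =
  Linked (λ a b → hd a ≡ tl b) ((e ∷ es) ∷ʳ e) × Unique (map tl (e ∷ es))

Σlist : ∀ {m} → (Fin m → ℕ) → List (Fin m) → ℕ
Σlist w C = foldr (λ e acc → w e ℕ.+ acc) 0 C

LocallyOptimal : ∀ {n m} → (src tgt : Fin m → Fin n) → (Fin m → ℕ) →
                 Orientation m → (Fin m → ℕ) → Set
LocallyOptimal {m = m} src tgt c d f =
  ∀ (C : List (Fin m)) → IsDirCycle (tailO src tgt d) (headO src tgt d) C →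
    Σlist (λ e → c e ℕ.* f e) C ℕ.≤ 3 ℕ.* Σlist c C

-- The digraph D = (V, (E⃗)⁻¹): arc for edge e is the reverse of the E⃗-arc,
-- i.e. it goes from headO e to tailO e.  Costs c'(e) = c(e)(3 - f(e)),
-- capacities l = 0, u = 1.
IsCirculation : ∀ {n m} → (src tgt : Fin m → Fin n) → Orientation m → (Fin m → ℤ) → Set
IsCirculation src tgt d g =
  (∀ e → (+ 0 ℤ.≤ g e) × (g e ℤ.≤ + 1))
  × Conserves (headO src tgt d) (tailO src tgt d) g

circCost : ∀ {m} → (Fin m → ℕ) → (Fin m → ℕ) → (Fin m → ℤ) → ℤ
circCost c f g = Σℤ (λ e → ((+ c e) * (+ 3 - + f e)) * g e)

IsMinCostCirculation : ∀ {n m} → (src tgt : Fin m → Fin n) → (c : Fin m → ℕ) →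
                       Orientation m → (Fin m → ℕ) → (Fin m → ℤ) → Set
IsMinCostCirculation src tgt c d f g =
  IsCirculation src tgt d g
  × (∀ h → IsCirculation src tgt d h → circCost c f g ℤ.≤ circCost c f h)

-- The integer function h (given by its values on the arcs e⁺) is a locally
-- optimal nowhere-zero k-flow: h is the extension of some nowhere-zero
-- k-flow (E⃗', f') which is locally optimal.
IsLocOptNZFlow : ∀ {n m} → (src tgt : Fin m → Fin n) → (c : Fin m → ℕ) → ℕ → (Fin m → ℤ) → Set
IsLocOptNZFlow {m = m} src tgt c k h =
  Σ (Orientation m) λ d' → Σ (Fin m → ℕ) λ f' →
    IsNZFlow src tgt k d' f' × (∀ e → extF d' f' e ≡ h e) × LocallyOptimal src tgt c d' f'

-- Where g = 1 the function f + 6g reverses the edge and carries 6 − f on it; where g = 0 it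
-- agrees with f.  So a 0/1 function g turns (E⃗, f) into an orientation E⃗′ with values f′ in
-- 1..5, and f + 6g conserves flow exactly when g does.  For two circulations g, h of D, the
-- difference h − g read along E⃗′ is a 0/1 circulation ρ of E⃗′, and cost(h) − cost(g) is its
-- weight under c(e)(3 − f′(e)); conversely every directed cycle of E⃗′ arises as such a ρ.
-- Hence g is optimal iff every nonnegative circulation of E⃗′ has nonnegative weight, which,
-- by peeling off directed cycles, holds iff every directed cycle C of E⃗′ satisfies
-- Σ_C c(3 − f′) ≥ 0, i.e. iff f + 6g is locally optimal.

module Submission where

open import Defs
open import Data.Bool using (Bool; true; false; if_then_else_; not)
open import Data.Fin as Fin using (Fin; zero; suc)
open import Data.Fin.Properties using (pigeonhole) renaming (_≟_ to _≟ᶠ_; any? to anyᶠ?)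
open import Data.Integer as ℤ using (ℤ; +_; -_; _+_; _*_; _-_; -[1+_]; +≤+; +<+; ∣_∣)
open import Data.Empty using (⊥-elim)
import Data.Integer.Properties as ℤP
open import Data.Integer.Tactic.RingSolver using (solve-∀)
open import Data.List using (List; []; _∷_; _∷ʳ_; foldr; tabulate; length; lookup)
open import Data.List.Properties using (length-map)
open import Data.List.Membership.Propositional using (_∈_)
open import Data.List.Membership.Propositional.Properties using (∈-lookup)
open import Data.List.Relation.Unary.All as All using (All; []; _∷_)
open import Data.List.Relation.Unary.All.Properties using (anti-mono; ¬Any⇒All¬)
open import Data.List.Relation.Unary.Any using (Any; here; there; any?)
open import Data.List.Relation.Unary.AllPairs using (AllPairs; []; _∷_)
import Data.List.Relation.Unary.AllPairs.Properties as AllPairs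
open import Data.List.Relation.Binary.Subset.Propositional using (_⊆_)
open import Data.List.Relation.Unary.Linked using (Linked; [-]; _∷_)
open import Data.List.Relation.Unary.Unique.Propositional using (Unique)
import Data.List.Relation.Unary.Unique.Propositional.Properties as Unique
open import Data.Nat as ℕ using (ℕ; zero; suc; z≤n; s≤s)
import Data.Nat.Properties as ℕP
open import Data.Product using (_×_; ∃; _,_; proj₁; proj₂)
open import Function using (_∘_; id)
open import Function.Bundles using (_⇔_; mk⇔; Equivalence)
open import Relation.Binary.PropositionalEquality
open import Relation.Nullary using (¬_; yes; no; contradiction)

open import Algebra.Properties.Semiring.Sum ℤP.+-*-semiring
  using (sum; ∑-distrib-+; sum-cong-≗; *-distribˡ-sum; sum-replicate-zero)
open import Algebra.Properties.Semiring.Sum ℕP.+-*-semiring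
  using () renaming (sum to sumℕ; ∑-distrib-+ to ∑ℕ-distrib-+; sum-cong-≗ to sumℕ-cong-≗)

pos-∸ : ∀ {r k} → k ℕ.≤ r → + (r ℕ.∸ k) ≡ + r - + k
pos-∸ {r} {k} k≤r = trans (sym (ℤP.⊖-≥ k≤r)) (sym (ℤP.m-n≡m⊖n r k))

term≤sumℕ : ∀ {m} (t : Fin m → ℕ) a → t a ℕ.≤ sumℕ t
term≤sumℕ t zero = ℕP.m≤m+n (t zero) _
term≤sumℕ t (suc a) = ℕP.≤-trans (term≤sumℕ (t ∘ suc) a) (ℕP.m≤n+m _ (t zero))

Σℤ≡sum : ∀ {m} (w : Fin m → ℤ) → Σℤ w ≡ sum w
Σℤ≡sum w = foldr-tabulate id
  where
  foldr-tabulate : ∀ {k} (σ : Fin k → Fin _) → foldr (λ e acc → w e + acc) (+ 0) (tabulate σ) ≡ sum (w ∘ σ)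
  foldr-tabulate {zero} σ = refl
  foldr-tabulate {suc k} σ = cong (_+_ (w (σ zero))) (foldr-tabulate (σ ∘ suc))

∑-distrib-− : ∀ {m} (t u : Fin m → ℤ) → sum (λ a → t a - u a) ≡ sum t - sum u
∑-distrib-− {zero} t u = refl
∑-distrib-− {suc m} t u = begin
  (t zero - u zero) + sum (λ a → t (suc a) - u (suc a))
    ≡⟨ cong (_+_ (t zero - u zero)) (∑-distrib-− (t ∘ suc) (u ∘ suc)) ⟩
  (t zero - u zero) + (sum (t ∘ suc) - sum (u ∘ suc))
    ≡⟨ interchange (t zero) (u zero) (sum (t ∘ suc)) (sum (u ∘ suc)) ⟩
  (t zero + sum (t ∘ suc)) - (u zero + sum (u ∘ suc)) ∎
  where
  open ≡-Reasoning
  interchange : ∀ (a b c d : ℤ) → (a - b) + (c - d) ≡ (a + c) - (b + d)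
  interchange = solve-∀

sum-zero : ∀ {m} (t : Fin m → ℤ) → (∀ a → t a ≡ + 0) → sum t ≡ + 0
sum-zero {m} t t≡0 = trans (sum-cong-≗ t≡0) (sum-replicate-zero m)

sum-nonneg : ∀ {m} (t : Fin m → ℤ) → (∀ a → + 0 ℤ.≤ t a) → + 0 ℤ.≤ sum t
sum-nonneg {zero} t t≥0 = ℤP.≤-refl
sum-nonneg {suc m} t t≥0 = ℤP.+-mono-≤ (t≥0 zero) (sum-nonneg (t ∘ suc) (t≥0 ∘ suc))

term≤sum : ∀ {m} (t : Fin m → ℤ) → (∀ a → + 0 ℤ.≤ t a) → ∀ a → t a ℤ.≤ sum t
term≤sum t t≥0 zero = begin
  t zero               ≡⟨ ℤP.+-identityʳ (t zero) ⟨
  t zero + + 0         ≤⟨ ℤP.+-monoʳ-≤ (t zero) (sum-nonneg (t ∘ suc) (t≥0 ∘ suc)) ⟩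
  t zero + sum (t ∘ suc) ∎
  where open ℤP.≤-Reasoning
term≤sum t t≥0 (suc a) = begin
  t (suc a)            ≤⟨ term≤sum (t ∘ suc) (t≥0 ∘ suc) a ⟩
  sum (t ∘ suc)        ≡⟨ ℤP.+-identityˡ (sum (t ∘ suc)) ⟨
  + 0 + sum (t ∘ suc)  ≤⟨ ℤP.+-monoˡ-≤ (sum (t ∘ suc)) (t≥0 zero) ⟩
  t zero + sum (t ∘ suc) ∎
  where open ℤP.≤-Reasoning

positive-sum⇒positive-term : ∀ {m} (t : Fin m → ℤ) → + 0 ℤ.< sum t → ∃ λ a → + 0 ℤ.< t a
positive-sum⇒positive-term {zero} t (+<+ ())
positive-sum⇒positive-term {suc m} t sum>0 with + 0 ℤ.<? t zero
... | yes t₀>0 = zero , t₀>0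
... | no t₀≯0 =
  let a , tₐ>0 = positive-sum⇒positive-term (t ∘ suc) (ℤP.<-≤-trans sum>0 drop-head) in suc a , tₐ>0
  where
  drop-head : sum t ℤ.≤ sum (t ∘ suc)
  drop-head = ℤP.≤-trans (ℤP.+-monoˡ-≤ (sum (t ∘ suc)) (ℤP.≮⇒≥ t₀≯0)) (ℤP.≤-reflexive (ℤP.+-identityˡ _))

[≡]ℤ-refl : ∀ {n} (u : Fin n) → [ u ≡ u ]ℤ ≡ + 1
[≡]ℤ-refl u with u ≟ᶠ u
... | yes _ = refl
... | no u≢u = contradiction refl u≢u

[suc≡suc]ℤ : ∀ {n} (u v : Fin n) → [ suc u ≡ suc v ]ℤ ≡ [ u ≡ v ]ℤ
[suc≡suc]ℤ u v with u ≟ᶠ v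
... | yes _ = refl
... | no _ = refl

sum-indicator : ∀ {m} (w : Fin m → ℤ) (x : Fin m) → sum (λ a → [ a ≡ x ]ℤ * w a) ≡ w x
sum-indicator {suc m} w zero = begin
  + 1 * w zero + sum {m} (λ _ → + 0) ≡⟨ cong₂ _+_ (ℤP.*-identityˡ (w zero)) (sum-zero {m} _ (λ _ → refl)) ⟩
  w zero + + 0                       ≡⟨ ℤP.+-identityʳ (w zero) ⟩
  w zero                             ∎
  where open ≡-Reasoning
sum-indicator {suc m} w (suc x) = begin
  + 0 + sum (λ a → [ suc a ≡ suc x ]ℤ * w (suc a)) ≡⟨ ℤP.+-identityˡ _ ⟩
  sum (λ a → [ suc a ≡ suc x ]ℤ * w (suc a))       ≡⟨ sum-cong-≗ (λ a → cong (_* w (suc a)) ([suc≡suc]ℤ a x)) ⟩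
  sum (λ a → [ a ≡ x ]ℤ * w (suc a))               ≡⟨ sum-indicator (w ∘ suc) x ⟩
  w (suc x)                                         ∎
  where open ≡-Reasoning

incidence : ∀ {n m} (tl hd : Fin m → Fin n) → Fin m → Fin n → ℤ
incidence tl hd a v = [ hd a ≡ v ]ℤ - [ tl a ≡ v ]ℤ

excess : ∀ {n m} (tl hd : Fin m → Fin n) → (Fin m → ℤ) → Fin n → ℤ
excess tl hd w v = sum (λ a → incidence tl hd a v * w a)

Balanced : ∀ {n m} (tl hd : Fin m → Fin n) → (Fin m → ℤ) → Set
Balanced tl hd w = ∀ v → excess tl hd w v ≡ + 0

module _ {n m : ℕ} (tl hd : Fin m → Fin n) where

  excess≡inflow-outflow : ∀ w v →
    excess tl hd w v ≡ sum (λ a → [ hd a ≡ v ]ℤ * w a) - sum (λ a → [ tl a ≡ v ]ℤ * w a)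
  excess≡inflow-outflow w v =
    trans (sum-cong-≗ (λ a → distrib [ hd a ≡ v ]ℤ [ tl a ≡ v ]ℤ (w a)))
          (∑-distrib-− (λ a → [ hd a ≡ v ]ℤ * w a) (λ a → [ tl a ≡ v ]ℤ * w a))
    where
    distrib : ∀ (p q x : ℤ) → (p - q) * x ≡ p * x - q * x
    distrib = solve-∀

  balanced⇒inflow≡outflow : ∀ {w} → Balanced tl hd w → ∀ v →
    sum (λ a → [ hd a ≡ v ]ℤ * w a) ≡ sum (λ a → [ tl a ≡ v ]ℤ * w a)
  balanced⇒inflow≡outflow b v = ℤP.i-j≡0⇒i≡j _ _ (trans (sym (excess≡inflow-outflow _ v)) (b v))

  conserves⇒balanced : ∀ {w} → Conserves tl hd w → Balanced tl hd w
  conserves⇒balanced {w} c v = trans (excess≡inflow-outflow w v) (ℤP.i≡j⇒i-j≡0 (begin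
    sum (λ a → [ hd a ≡ v ]ℤ * w a) ≡⟨ Σℤ≡sum (λ a → [ hd a ≡ v ]ℤ * w a) ⟨
    Σℤ (λ a → [ hd a ≡ v ]ℤ * w a)  ≡⟨ c v ⟩
    Σℤ (λ a → [ tl a ≡ v ]ℤ * w a)  ≡⟨ Σℤ≡sum (λ a → [ tl a ≡ v ]ℤ * w a) ⟩
    sum (λ a → [ tl a ≡ v ]ℤ * w a) ∎))
    where open ≡-Reasoning

  balanced⇒conserves : ∀ {w} → Balanced tl hd w → Conserves tl hd w
  balanced⇒conserves {w} b v = begin
    Σℤ (λ a → [ hd a ≡ v ]ℤ * w a)  ≡⟨ Σℤ≡sum (λ a → [ hd a ≡ v ]ℤ * w a) ⟩
    sum (λ a → [ hd a ≡ v ]ℤ * w a) ≡⟨ balanced⇒inflow≡outflow b v ⟩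
    sum (λ a → [ tl a ≡ v ]ℤ * w a) ≡⟨ Σℤ≡sum (λ a → [ tl a ≡ v ]ℤ * w a) ⟨
    Σℤ (λ a → [ tl a ≡ v ]ℤ * w a)  ∎
    where open ≡-Reasoning

  excess-cong : ∀ {w w′} → (∀ a → w a ≡ w′ a) → ∀ v → excess tl hd w v ≡ excess tl hd w′ v
  excess-cong w≗w′ v = sum-cong-≗ (λ a → cong (incidence tl hd a v *_) (w≗w′ a))

  excess-+ : ∀ w w′ v → excess tl hd (λ a → w a + w′ a) v ≡ excess tl hd w v + excess tl hd w′ v
  excess-+ w w′ v = trans (sum-cong-≗ (λ a → ℤP.*-distribˡ-+ (incidence tl hd a v) (w a) (w′ a)))
                          (∑-distrib-+ (λ a → incidence tl hd a v * w a) (λ a → incidence tl hd a v * w′ a))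

  excess-− : ∀ w w′ v → excess tl hd (λ a → w a - w′ a) v ≡ excess tl hd w v - excess tl hd w′ v
  excess-− w w′ v = trans (sum-cong-≗ (λ a → distrib (incidence tl hd a v) (w a) (w′ a)))
                          (∑-distrib-− (λ a → incidence tl hd a v * w a) (λ a → incidence tl hd a v * w′ a))
    where
    distrib : ∀ (p x y : ℤ) → p * (x - y) ≡ p * x - p * y
    distrib = solve-∀

  excess-* : ∀ k w v → excess tl hd (λ a → k * w a) v ≡ k * excess tl hd w v
  excess-* k w v = trans (sum-cong-≗ (λ a → swap (incidence tl hd a v) k (w a)))
                           (sym (*-distribˡ-sum k (λ a → incidence tl hd a v * w a)))
    where
    swap : ∀ (p k x : ℤ) → p * (k * x) ≡ k * (p * x)
    swap = solve-∀

  excess-+* : ∀ w k w′ v → excess tl hd (λ a → w a + k * w′ a) v ≡ excess tl hd w v + k * excess tl hd w′ v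
  excess-+* w k w′ v = trans (excess-+ w (λ a → k * w′ a) v) (cong (_+_ (excess tl hd w v)) (excess-* k w′ v))

signed signedRev : Bool → ℤ → ℤ
signed b z = if b then z else - z
signedRev b z = if b then - z else z

module _ {n m : ℕ} (src tgt : Fin m → Fin n) (d : Orientation m) where

  private
    flip-sign : ∀ (p q x : ℤ) → (q - p) * x ≡ (p - q) * - x
    flip-sign = solve-∀

  excess-oriented : ∀ w v →
    excess (tailO src tgt d) (headO src tgt d) w v ≡ excess src tgt (λ a → signed (d a) (w a)) v
  excess-oriented w v = sum-cong-≗ termwise
    where
    termwise : ∀ a → incidence (tailO src tgt d) (headO src tgt d) a v * w a
                   ≡ incidence src tgt a v * signed (d a) (w a)
    termwise a with d a
    ... | true = refl
    ... | false = flip-sign [ tgt a ≡ v ]ℤ [ src a ≡ v ]ℤ (w a)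

  excess-reversed : ∀ w v →
    excess (headO src tgt d) (tailO src tgt d) w v ≡ excess src tgt (extR d w) v
  excess-reversed w v = sum-cong-≗ termwise
    where
    termwise : ∀ a → incidence (headO src tgt d) (tailO src tgt d) a v * w a
                   ≡ incidence src tgt a v * extR d w a
    termwise a with d a
    ... | true = flip-sign [ tgt a ≡ v ]ℤ [ src a ≡ v ]ℤ (w a)
    ... | false = refl

listSum : ∀ {m} → (Fin m → ℤ) → List (Fin m) → ℤ
listSum w = foldr (λ e acc → w e + acc) (+ 0)

multiplicity : ∀ {m} → List (Fin m) → Fin m → ℕ
multiplicity [] a = 0
multiplicity (x ∷ C) a with a ≟ᶠ x
... | yes _ = suc (multiplicity C a)
... | no _ = multiplicity C a

multiplicity-∷ : ∀ {m} (x : Fin m) C a → + multiplicity (x ∷ C) a ≡ [ a ≡ x ]ℤ + + multiplicity C a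
multiplicity-∷ x C a with a ≟ᶠ x
... | yes _ = refl
... | no _ = refl

sum-multiplicity : ∀ {m} (w : Fin m → ℤ) C → sum (λ a → + multiplicity C a * w a) ≡ listSum w C
sum-multiplicity w [] = sum-zero _ (λ a → ℤP.*-zeroˡ (w a))
sum-multiplicity w (x ∷ C) = begin
  sum (λ a → + multiplicity (x ∷ C) a * w a)
    ≡⟨ sum-cong-≗ (λ a → trans (cong (_* w a) (multiplicity-∷ x C a)) (ℤP.*-distribʳ-+ (w a) [ a ≡ x ]ℤ _)) ⟩
  sum (λ a → [ a ≡ x ]ℤ * w a + + multiplicity C a * w a)
    ≡⟨ ∑-distrib-+ (λ a → [ a ≡ x ]ℤ * w a) (λ a → + multiplicity C a * w a) ⟩
  sum (λ a → [ a ≡ x ]ℤ * w a) + sum (λ a → + multiplicity C a * w a)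
    ≡⟨ cong₂ _+_ (sum-indicator w x) (sum-multiplicity w C) ⟩
  w x + listSum w C ∎
  where open ≡-Reasoning

multiplicity-head : ∀ {m} (x : Fin m) C → 1 ℕ.≤ multiplicity (x ∷ C) x
multiplicity-head x C with x ≟ᶠ x
... | yes _ = s≤s z≤n
... | no x≢x = contradiction refl x≢x

multiplicity-∉ : ∀ {m} C (a : Fin m) → All (λ y → ¬ a ≡ y) C → multiplicity C a ≡ 0
multiplicity-∉ [] a [] = refl
multiplicity-∉ (x ∷ C) a (a≢x ∷ a∉C) with a ≟ᶠ x
... | yes a≡x = contradiction a≡x a≢x
... | no _ = multiplicity-∉ C a a∉C

unique⇒multiplicity≤1 : ∀ {m} {C : List (Fin m)} → Unique C → ∀ a → multiplicity C a ℕ.≤ 1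
unique⇒multiplicity≤1 [] a = z≤n
unique⇒multiplicity≤1 {C = x ∷ C} (x∉C ∷ C!) a with a ≟ᶠ x
... | yes refl = s≤s (ℕP.≤-reflexive (multiplicity-∉ C a x∉C))
... | no _ = unique⇒multiplicity≤1 C! a

multiplicity>0⇒∈ : ∀ {m} C (a : Fin m) → 0 ℕ.< multiplicity C a → a ∈ C
multiplicity>0⇒∈ (x ∷ C) a pos with a ≟ᶠ x
... | yes a≡x = here a≡x
... | no _ = there (multiplicity>0⇒∈ C a pos)

module _ {n m : ℕ} (tl hd : Fin m → Fin n) where

  telescope : ∀ (F : Fin n → ℤ) x xs z → Linked (λ a b → hd a ≡ tl b) ((x ∷ xs) ∷ʳ z) →
              listSum (λ a → F (hd a) - F (tl a)) (x ∷ xs) ≡ F (tl z) - F (tl x)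
  telescope F x [] z (hd-x≡tl-z ∷ [-]) = begin
    F (hd x) - F (tl x) + + 0 ≡⟨ ℤP.+-identityʳ _ ⟩
    F (hd x) - F (tl x)       ≡⟨ cong (λ u → F u - F (tl x)) hd-x≡tl-z ⟩
    F (tl z) - F (tl x)       ∎
    where open ≡-Reasoning
  telescope F x (y ∷ ys) z (hd-x≡tl-y ∷ linked) = begin
    F (hd x) - F (tl x) + listSum (λ a → F (hd a) - F (tl a)) (y ∷ ys)
      ≡⟨ cong₂ (λ u s → F u - F (tl x) + s) hd-x≡tl-y (telescope F y ys z linked) ⟩
    F (tl y) - F (tl x) + (F (tl z) - F (tl y))
      ≡⟨ cancel (F (tl y)) (F (tl x)) (F (tl z)) ⟩
    F (tl z) - F (tl x) ∎
    where
    open ≡-Reasoning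
    cancel : ∀ (p q r : ℤ) → p - q + (r - p) ≡ r - q
    cancel = solve-∀

  cycle-balanced : ∀ C → IsDirCycle tl hd C → Balanced tl hd (λ a → + multiplicity C a)
  cycle-balanced (e ∷ es) (closed , _) v = begin
    sum (λ a → incidence tl hd a v * + multiplicity (e ∷ es) a)
      ≡⟨ sum-cong-≗ (λ a → ℤP.*-comm (incidence tl hd a v) _) ⟩
    sum (λ a → + multiplicity (e ∷ es) a * incidence tl hd a v)
      ≡⟨ sum-multiplicity (λ a → incidence tl hd a v) (e ∷ es) ⟩
    listSum (λ a → incidence tl hd a v) (e ∷ es)
      ≡⟨ telescope (λ u → [ u ≡ v ]ℤ) e es e closed ⟩
    [ tl e ≡ v ]ℤ - [ tl e ≡ v ]ℤ
      ≡⟨ ℤP.+-inverseʳ [ tl e ≡ v ]ℤ ⟩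
    + 0 ∎
    where open ≡-Reasoning

-- A directed cycle through the support of a nonnegative circulation

unique-lookup : ∀ {k} {xs : List (Fin k)} → Unique xs → ∀ {i j} → i Fin.< j → ¬ lookup xs i ≡ lookup xs j
unique-lookup (x∉xs ∷ xs!) {zero} {suc j} _ = All.lookup x∉xs (∈-lookup j)
unique-lookup (x∉xs ∷ xs!) {suc i} {suc j} (s≤s i<j) = unique-lookup xs! i<j

unique⇒length≤ : ∀ {k} {xs : List (Fin k)} → Unique xs → length xs ℕ.≤ k
unique⇒length≤ {k} {xs} xs! with length xs ℕ.≤? k
... | yes ≤k = ≤k
... | no ≰k with i , j , i<j , same ← pigeonhole (ℕP.≰⇒> ≰k) (lookup xs) =
  contradiction same (unique-lookup xs! i<j)

module _ {n m : ℕ} (tl hd : Fin m → Fin n) where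

  private
    _↝_ : Fin m → Fin m → Set
    x ↝ y = hd x ≡ tl y

    DistinctTails : List (Fin m) → Set
    DistinctTails = AllPairs (λ x y → ¬ tl x ≡ tl y)

  cutAtTail : ∀ z x P → Linked _↝_ (x ∷ P) → DistinctTails P → Any (λ y → tl z ≡ tl y) P →
              ∃ λ Q → Linked _↝_ ((x ∷ Q) ∷ʳ z) × All (λ y → ¬ tl z ≡ tl y) Q × DistinctTails Q × Q ⊆ P
  cutAtTail z x (p ∷ P) (x↝p ∷ linked) (p-fresh ∷ distinct) found with tl z ≟ᶠ tl p
  ... | yes same = [] , (trans x↝p (sym same) ∷ [-]) , [] , [] , λ ()
  ... | no differ with found
  ...   | here same = contradiction same differ
  ...   | there found′ with Q , closed , fresh , distinct′ , Q⊆P ← cutAtTail z p P linked distinct found′ =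
    p ∷ Q , x↝p ∷ closed , differ ∷ fresh , anti-mono Q⊆P p-fresh ∷ distinct′ ,
    λ { (here refl) → here refl ; (there i) → there (Q⊆P i) }

  module _ (ρ : Fin m → ℕ) (balanced : Balanced tl hd (λ a → + ρ a)) where

    private
      Active : Fin m → Set
      Active a = 0 ℕ.< ρ a

      weighted-nonneg : ∀ (u v : Fin n) r → + 0 ℤ.≤ [ u ≡ v ]ℤ * + r
      weighted-nonneg u v r with u ≟ᶠ v
      ... | yes _ = ℤP.≤-trans (+≤+ z≤n) (ℤP.≤-reflexive (sym (ℤP.*-identityˡ (+ r))))
      ... | no _ = ℤP.≤-refl

      weighted-positive : ∀ (u v : Fin n) r → + 0 ℤ.< [ u ≡ v ]ℤ * + r → u ≡ v × 0 ℕ.< r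
      weighted-positive u v r pos with u ≟ᶠ v
      ... | yes u≡v = u≡v , ℤP.drop‿+<+ (subst (+ 0 ℤ.<_) (ℤP.*-identityˡ (+ r)) pos)
      ... | no _ = contradiction pos λ { (+<+ ()) }

    in-arc : ∀ a → 0 ℕ.< ρ a → ∃ λ b → hd b ≡ tl a × 0 ℕ.< ρ b
    in-arc a active =
      let b , pos = positive-sum⇒positive-term (λ b → [ hd b ≡ tl a ]ℤ * + ρ b) inflow>0
          hd-b≡tl-a , active-b = weighted-positive (hd b) (tl a) (ρ b) pos
      in b , hd-b≡tl-a , active-b
      where
      open ℤP.≤-Reasoning
      inflow>0 : + 0 ℤ.< sum (λ b → [ hd b ≡ tl a ]ℤ * + ρ b)
      inflow>0 = begin-strict
        + 0                                  <⟨ +<+ active ⟩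
        + ρ a                                ≡⟨ ℤP.*-identityˡ (+ ρ a) ⟨
        + 1 * + ρ a                          ≡⟨ cong (_* + ρ a) ([≡]ℤ-refl (tl a)) ⟨
        [ tl a ≡ tl a ]ℤ * + ρ a             ≤⟨ term≤sum _ (λ b → weighted-nonneg (tl b) (tl a) (ρ b)) a ⟩
        sum (λ b → [ tl b ≡ tl a ]ℤ * + ρ b) ≡⟨ balanced⇒inflow≡outflow tl hd balanced (tl a) ⟨
        sum (λ b → [ hd b ≡ tl a ]ℤ * + ρ b) ∎

    -- Walk backwards along active in-arcs; the tails on the path stay distinct, so a tail
    -- repeats, closing a cycle, within n steps.
    private
      grow : ∀ fuel a P → n ℕ.< length (a ∷ P) ℕ.+ fuel →
             Linked _↝_ (a ∷ P) → DistinctTails (a ∷ P) → All Active (a ∷ P) →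
             ∃ λ C → IsDirCycle tl hd C × All Active C
      grow zero a P overfull _ distinct _ =
        ⊥-elim (ℕP.<⇒≱ (subst (n ℕ.<_) (ℕP.+-identityʳ _) overfull)
                       (subst (ℕ._≤ n) (length-map tl (a ∷ P)) (unique⇒length≤ (AllPairs.map⁺ distinct))))
      grow (suc fuel) a P overfull linked distinct actives@(active ∷ _)
        with b , b↝a , active-b ← in-arc a active
        with any? (λ y → tl b ≟ᶠ tl y) (a ∷ P)
      ... | yes repeated
        with Q , closed , fresh , distinct′ , Q⊆ ← cutAtTail b b (a ∷ P) (b↝a ∷ linked) distinct repeated =
        b ∷ Q , (closed , AllPairs.map⁺ (fresh ∷ distinct′)) , active-b ∷ anti-mono Q⊆ actives
      ... | no new =
        grow fuel b (a ∷ P) (subst (n ℕ.<_) (cong suc (ℕP.+-suc (length P) fuel)) overfull)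
             (b↝a ∷ linked) (¬Any⇒All¬ (a ∷ P) new ∷ distinct) (active-b ∷ actives)

    active-cycle : ∀ a → 0 ℕ.< ρ a → ∃ λ C → IsDirCycle tl hd C × All (λ b → 0 ℕ.< ρ b) C
    active-cycle a active = grow n a [] (ℕP.n<1+n n) [-] ([] ∷ []) (active ∷ [])

-- Peeling cycles off a nonnegative circulation

dirCycle⇒unique : ∀ {n m} {tl hd : Fin m → Fin n} {C} → IsDirCycle tl hd C → Unique C
dirCycle⇒unique {C = _ ∷ _} (_ , tails!) = Unique.map⁻ tails!

cycle-length>0 : ∀ {n m} {tl hd : Fin m → Fin n} {C} → IsDirCycle tl hd C → 0 ℕ.< sumℕ (multiplicity C)
cycle-length>0 {C = e ∷ es} _ = ℕP.<-≤-trans (multiplicity-head e es) (term≤sumℕ (multiplicity (e ∷ es)) e)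

module Residual {n m : ℕ} (tl hd : Fin m → Fin n) (ρ : Fin m → ℕ) (balanced : Balanced tl hd (λ a → + ρ a))
         (C : List (Fin m)) (cycle : IsDirCycle tl hd C) (actives : All (λ a → 0 ℕ.< ρ a) C) where

  residual : Fin m → ℕ
  residual a = ρ a ℕ.∸ multiplicity C a

  private
    multiplicity≤ρ : ∀ a → multiplicity C a ℕ.≤ ρ a
    multiplicity≤ρ a with multiplicity C a in eq
    ... | zero = z≤n
    ... | suc k = ℕP.≤-trans (subst (ℕ._≤ 1) eq (unique⇒multiplicity≤1 (dirCycle⇒unique cycle) a))
                             (All.lookup actives (multiplicity>0⇒∈ C a (subst (0 ℕ.<_) (sym eq) (s≤s z≤n))))

    residual-split : ∀ a → residual a ℕ.+ multiplicity C a ≡ ρ a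
    residual-split a = ℕP.m∸n+n≡m (multiplicity≤ρ a)

  residual-balanced : Balanced tl hd (λ a → + residual a)
  residual-balanced v = begin
    excess tl hd (λ a → + residual a) v
      ≡⟨ excess-cong tl hd (λ a → pos-∸ (multiplicity≤ρ a)) v ⟩
    excess tl hd (λ a → + ρ a - + multiplicity C a) v
      ≡⟨ excess-− tl hd (λ a → + ρ a) (λ a → + multiplicity C a) v ⟩
    excess tl hd (λ a → + ρ a) v - excess tl hd (λ a → + multiplicity C a) v
      ≡⟨ cong₂ _-_ (balanced v) (cycle-balanced tl hd C cycle v) ⟩
    + 0 ∎
    where open ≡-Reasoning

  residual-weight : ∀ (w : Fin m → ℤ) →
    sum (λ a → + ρ a * w a) ≡ sum (λ a → + residual a * w a) + listSum w C
  residual-weight w = begin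
    sum (λ a → + ρ a * w a)
      ≡⟨ sum-cong-≗ (λ a → cong (λ r → + r * w a) (residual-split a)) ⟨
    sum (λ a → + (residual a ℕ.+ multiplicity C a) * w a)
      ≡⟨ sum-cong-≗ (λ a → ℤP.*-distribʳ-+ (w a) (+ residual a) (+ multiplicity C a)) ⟩
    sum (λ a → + residual a * w a + + multiplicity C a * w a)
      ≡⟨ ∑-distrib-+ (λ a → + residual a * w a) (λ a → + multiplicity C a * w a) ⟩
    sum (λ a → + residual a * w a) + sum (λ a → + multiplicity C a * w a)
      ≡⟨ cong (_+_ (sum (λ a → + residual a * w a))) (sum-multiplicity w C) ⟩
    sum (λ a → + residual a * w a) + listSum w C ∎
    where open ≡-Reasoning

  residual-smaller : sumℕ residual ℕ.< sumℕ ρ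
  residual-smaller = begin-strict
    sumℕ residual                                   <⟨ ℕP.m<m+n (sumℕ residual) (cycle-length>0 cycle) ⟩
    sumℕ residual ℕ.+ sumℕ (multiplicity C)         ≡⟨ ∑ℕ-distrib-+ residual (multiplicity C) ⟨
    sumℕ (λ a → residual a ℕ.+ multiplicity C a)    ≡⟨ sumℕ-cong-≗ residual-split ⟩
    sumℕ ρ ∎
    where open ℕP.≤-Reasoning

module _ {n m : ℕ} (tl hd : Fin m → Fin n) (w : Fin m → ℤ)
         (cycles-nonneg : ∀ C → IsDirCycle tl hd C → + 0 ℤ.≤ listSum w C) where

  circulation-weight-nonneg : ∀ ρ → Balanced tl hd (λ a → + ρ a) → + 0 ℤ.≤ sum (λ a → + ρ a * w a)
  circulation-weight-nonneg ρ = go (suc (sumℕ ρ)) ρ (ℕP.n<1+n (sumℕ ρ))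
    where
    go : ∀ fuel ρ → sumℕ ρ ℕ.< fuel → Balanced tl hd (λ a → + ρ a) → + 0 ℤ.≤ sum (λ a → + ρ a * w a)
    go (suc fuel) ρ bound balanced with anyᶠ? (λ a → 0 ℕ.<? ρ a)
    ... | no none-active = ℤP.≤-reflexive (sym (sum-zero _ (λ a →
          trans (cong (λ r → + r * w a) (ℕP.n≤0⇒n≡0 (ℕP.≮⇒≥ (λ active → none-active (a , active)))))
                (ℤP.*-zeroˡ (w a)))))
    ... | yes (a , active) with C , cycle , actives ← active-cycle tl hd ρ balanced a active =
      let open Residual tl hd ρ balanced C cycle actives in
      subst (+ 0 ℤ.≤_) (sym (residual-weight w))
        (ℤP.+-mono-≤ (go fuel residual (ℕP.<-≤-trans residual-smaller (ℕP.≤-pred bound)) residual-balanced)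
                     (cycles-nonneg C cycle))

-- One edge: the flows f and f + 6g

data Bit : ℤ → Set where
  0ᵇ : Bit (+ 0)
  1ᵇ : Bit (+ 1)

bit : ∀ {h} → + 0 ℤ.≤ h → h ℤ.≤ + 1 → Bit h
bit {+ 0} _ _ = 0ᵇ
bit {+ 1} _ _ = 1ᵇ
bit {+ suc (suc _)} _ (+≤+ (s≤s ()))

bit-range : ∀ {h} → Bit h → + 0 ℤ.≤ h × h ℤ.≤ + 1
bit-range 0ᵇ = +≤+ z≤n , +≤+ z≤n
bit-range 1ᵇ = +≤+ z≤n , +≤+ (s≤s z≤n)

-- (b′, x′) is the orientation and value that f + 6g gives an edge carrying x along b.
data Switch : Bool → ℕ → ℤ → Bool → ℕ → Set where
  stay : ∀ {b x} → Switch b x (+ 0) b x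
  flip : ∀ {b x} → Switch b x (+ 1) (not b) (6 ℕ.∸ x)

switch : ∀ b x {y} → Bit y → ∃ λ b′ → ∃ λ x′ → Switch b x y b′ x′
switch b x 0ᵇ = b , x , stay
switch b x 1ᵇ = not b , 6 ℕ.∸ x , flip

switch-bit : ∀ {b x y b′ x′} → Switch b x y b′ x′ → Bit y
switch-bit stay = 0ᵇ
switch-bit flip = 1ᵇ

switch-range : ∀ {b x y b′ x′} → Switch b x y b′ x′ → 1 ℕ.≤ x × x ℕ.≤ 5 → 1 ℕ.≤ x′ × x′ ℕ.≤ 5
switch-range stay x∈ = x∈
switch-range {x = x} flip (1≤x , x≤5) = ℕP.∸-monoʳ-≤ 6 x≤5 , ℕP.∸-monoʳ-≤ 6 1≤x

switch-flow : ∀ {b x y b′ x′} → Switch b x y b′ x′ → x ℕ.≤ 6 →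
              signed b′ (+ x′) ≡ signed b (+ x) + + 6 * signedRev b y
switch-flow {true} stay _ = sym (ℤP.+-identityʳ _)
switch-flow {false} stay _ = sym (ℤP.+-identityʳ _)
switch-flow {true} {x} flip x≤6 = trans (cong -_ (pos-∸ x≤6)) (rearrange (+ x))
  where
  rearrange : ∀ (X : ℤ) → - (+ 6 - X) ≡ X + + 6 * - + 1
  rearrange = solve-∀
switch-flow {false} {x} flip x≤6 = trans (pos-∸ x≤6) (rearrange (+ x))
  where
  rearrange : ∀ (X : ℤ) → + 6 - X ≡ - X + + 6 * + 1
  rearrange = solve-∀

private
  from-plus : ∀ (X y : ℤ) → + 6 * y ≡ X - (X + + 6 * - y)
  from-plus = solve-∀

  from-minus : ∀ (X y : ℤ) → + 6 * y ≡ X + (- X + + 6 * y)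
  from-minus = solve-∀

  6k≰-difference : ∀ k {x x′} → + 6 * + suc k ≡ + x - + x′ → ¬ x ℕ.≤ 5
  6k≰-difference k {x} {x′} eq x≤5 = ℕP.<⇒≱ (s≤s x≤5) (begin
    6                  ≤⟨ ℕP.m≤m*n 6 (suc k) ⟩
    6 ℕ.* suc k        ≤⟨ ℕP.m≤m+n (6 ℕ.* suc k) x′ ⟩
    6 ℕ.* suc k ℕ.+ x′ ≡⟨ ℤP.+-injective lifted ⟩
    x                  ∎)
    where
    open ℕP.≤-Reasoning
    cancel : ∀ (p q : ℤ) → p - q + q ≡ p
    cancel = solve-∀
    lifted : + (6 ℕ.* suc k ℕ.+ x′) ≡ + x
    lifted = trans (ℤP.pos-+ (6 ℕ.* suc k) x′)
                   (trans (cong (_+ + x′) (trans (ℤP.pos-* 6 (suc k)) eq)) (cancel (+ x) (+ x′)))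

  6y≡difference⇒y≡0 : ∀ y {x x′} → + 6 * y ≡ + x - + x′ → x ℕ.≤ 5 → x′ ℕ.≤ 5 → y ≡ + 0
  6y≡difference⇒y≡0 (+ zero) _ _ _ = refl
  6y≡difference⇒y≡0 (+ suc k) {x′ = x′} eq x≤5 _ = ⊥-elim (6k≰-difference k {x′ = x′} eq x≤5)
  6y≡difference⇒y≡0 -[1+ k ] {x} {x′} eq _ x′≤5 = ⊥-elim (6k≰-difference k {x′ = x} negated x′≤5)
    where
    negate-product : ∀ r → + 6 * r ≡ - (+ 6 * - r)
    negate-product = solve-∀
    negate-difference : ∀ p q → - (p - q) ≡ q - p
    negate-difference = solve-∀
    negated : + 6 * + suc k ≡ + x′ - + x
    negated = trans (negate-product (+ suc k)) (trans (cong -_ eq) (negate-difference (+ x) (+ x′)))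

  6y≡sum⇒y≡1 : ∀ y {x x′} → + 6 * y ≡ + x + + x′ → 1 ℕ.≤ x → x ℕ.≤ 5 → x′ ℕ.≤ 5 → y ≡ + 1
  6y≡sum⇒y≡1 (+ zero) {x} {x′} eq 1≤x _ _ =
    ⊥-elim (ℕP.<⇒≱ (ℕP.<-≤-trans 1≤x (ℕP.m≤m+n x x′)) (ℕP.≤-reflexive (sym (ℤP.+-injective eq))))
  6y≡sum⇒y≡1 (+ 1) _ _ _ _ = refl
  6y≡sum⇒y≡1 (+ suc (suc j)) {x} {x′} eq _ x≤5 x′≤5 =
    ⊥-elim (ℕP.≤⇒≯ (ℕP.+-mono-≤ x≤5 x′≤5) (begin
      11                 ≤⟨ ℕP.n≤1+n 11 ⟩
      12                 ≤⟨ ℕP.*-monoʳ-≤ 6 (s≤s (s≤s (z≤n {j}))) ⟩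
      6 ℕ.* suc (suc j)  ≡⟨ ℤP.+-injective (trans (ℤP.pos-* 6 (suc (suc j))) eq) ⟩
      x ℕ.+ x′           ∎))
    where open ℕP.≤-Reasoning

  stay-from : ∀ {b x y x′} → + 6 * y ≡ + x - + x′ → x ℕ.≤ 5 → x′ ℕ.≤ 5 → Switch b x y b x′
  stay-from {x = x} {y} {x′} eq x≤5 x′≤5 with refl ← 6y≡difference⇒y≡0 y eq x≤5 x′≤5
    with refl ← ℤP.+-injective (ℤP.i-j≡0⇒i≡j (+ x) (+ x′) (sym eq)) = stay

  flip-from : ∀ {b x y x′} → + 6 * y ≡ + x + + x′ → 1 ℕ.≤ x → x ℕ.≤ 5 → x′ ℕ.≤ 5 → Switch b x y (not b) x′
  flip-from {x = x} {y} {x′} eq 1≤x x≤5 x′≤5 with refl ← 6y≡sum⇒y≡1 y eq 1≤x x≤5 x′≤5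
    with refl ← trans (sym (ℕP.m+n∸m≡n x x′)) (cong (ℕ._∸ x) (sym (ℤP.+-injective eq))) = flip

classify : ∀ {b x y b′ x′} → 1 ℕ.≤ x × x ℕ.≤ 5 → x′ ℕ.≤ 5 →
           signed b′ (+ x′) ≡ signed b (+ x) + + 6 * signedRev b y → Switch b x y b′ x′
classify {true} {x} {y} {true} (_ , x≤5) x′≤5 eq =
  stay-from (trans (from-plus (+ x) y) (cong (_-_ (+ x)) (sym eq))) x≤5 x′≤5
classify {true} {x} {y} {false} {x′} (1≤x , x≤5) x′≤5 eq =
  flip-from (trans (from-plus (+ x) y)
                   (trans (cong (_-_ (+ x)) (sym eq)) (cong (_+_ (+ x)) (ℤP.neg-involutive (+ x′)))))
            1≤x x≤5 x′≤5
classify {false} {x} {y} {true} (1≤x , x≤5) x′≤5 eq =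
  flip-from (trans (from-minus (+ x) y) (cong (_+_ (+ x)) (sym eq))) 1≤x x≤5 x′≤5
classify {false} {x} {y} {false} (_ , x≤5) x′≤5 eq =
  stay-from (trans (from-minus (+ x) y) (cong (_+_ (+ x)) (sym eq))) x≤5 x′≤5

switch-residual : ∀ {b x y b′ x′ h} → Switch b x y b′ x′ → Bit h →
                  signedRev b h ≡ signedRev b y - signed b′ (+ ∣ h - y ∣)
switch-residual {true} stay 0ᵇ = refl
switch-residual {false} stay 0ᵇ = refl
switch-residual {true} stay 1ᵇ = refl
switch-residual {false} stay 1ᵇ = refl
switch-residual {true} flip 0ᵇ = refl
switch-residual {false} flip 0ᵇ = refl
switch-residual {true} flip 1ᵇ = refl
switch-residual {false} flip 1ᵇ = refl

switch-cost : ∀ {b x y b′ x′ h} → Switch b x y b′ x′ → x ℕ.≤ 6 → Bit h → ∀ K →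
              K * (+ 3 - + x) * h - K * (+ 3 - + x) * y ≡ + ∣ h - y ∣ * (K * (+ 3 - + x′))
switch-cost {x = x} stay _ 0ᵇ K = stay-idle K (+ x)
  where
  stay-idle : ∀ (K X : ℤ) → K * (+ 3 - X) * + 0 - K * (+ 3 - X) * + 0 ≡ + 0 * (K * (+ 3 - X))
  stay-idle = solve-∀
switch-cost {x = x} stay _ 1ᵇ K = stay-used K (+ x)
  where
  stay-used : ∀ (K X : ℤ) → K * (+ 3 - X) * + 1 - K * (+ 3 - X) * + 0 ≡ + 1 * (K * (+ 3 - X))
  stay-used = solve-∀
switch-cost {x = x} flip x≤6 0ᵇ K =
  trans (flip-used K (+ x)) (cong (λ z → + 1 * (K * (+ 3 - z))) (sym (pos-∸ x≤6)))
  where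
  flip-used : ∀ (K X : ℤ) → K * (+ 3 - X) * + 0 - K * (+ 3 - X) * + 1 ≡ + 1 * (K * (+ 3 - (+ 6 - X)))
  flip-used = solve-∀
switch-cost {x = x} flip _ 1ᵇ K = flip-idle K (+ x) (+ (6 ℕ.∸ x))
  where
  flip-idle : ∀ (K X X′ : ℤ) → K * (+ 3 - X) * + 1 - K * (+ 3 - X) * + 1 ≡ + 0 * (K * (+ 3 - X′))
  flip-idle = solve-∀

toggle : ∀ {y} → Bit y → ∀ {r} → r ℕ.≤ 1 → ∃ λ h → Bit h × ∣ h - y ∣ ≡ r
toggle 0ᵇ {0} _ = + 0 , 0ᵇ , refl
toggle 0ᵇ {1} _ = + 1 , 1ᵇ , refl
toggle 1ᵇ {0} _ = + 1 , 1ᵇ , refl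
toggle 1ᵇ {1} _ = + 0 , 0ᵇ , refl
toggle _ {suc (suc _)} (s≤s ())

reducedCost : ∀ {m} → (Fin m → ℕ) → (Fin m → ℕ) → Fin m → ℤ
reducedCost c f e = + c e * (+ 3 - + f e)

listSum-reducedCost : ∀ {m} (c f : Fin m → ℕ) C →
  listSum (reducedCost c f) C ≡ + (3 ℕ.* Σlist c C) - + Σlist (λ e → c e ℕ.* f e) C
listSum-reducedCost c f [] = refl
listSum-reducedCost c f (e ∷ C) = begin
  reducedCost c f e + listSum (reducedCost c f) C
    ≡⟨ cong (_+_ (reducedCost c f e)) (listSum-reducedCost c f C) ⟩
  + c e * (+ 3 - + f e) + (+ (3 ℕ.* S) - + T)
    ≡⟨ cong (λ p → + c e * (+ 3 - + f e) + (p - + T)) (ℤP.pos-* 3 S) ⟩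
  + c e * (+ 3 - + f e) + (+ 3 * + S - + T)
    ≡⟨ regroup (+ c e) (+ f e) (+ S) (+ T) ⟩
  + 3 * (+ c e + + S) - (+ c e * + f e + + T)
    ≡⟨ cong₂ _-_ (trans (cong (+ 3 *_) (sym (ℤP.pos-+ (c e) S))) (sym (ℤP.pos-* 3 (c e ℕ.+ S))))
                 (trans (cong (_+ + T) (sym (ℤP.pos-* (c e) (f e)))) (sym (ℤP.pos-+ (c e ℕ.* f e) T))) ⟩
  + (3 ℕ.* (c e ℕ.+ S)) - + (c e ℕ.* f e ℕ.+ T) ∎
  where
  open ≡-Reasoning
  S T : ℕ
  S = Σlist c C
  T = Σlist (λ e → c e ℕ.* f e) C
  regroup : ∀ (k x s t : ℤ) → k * (+ 3 - x) + (+ 3 * s - t) ≡ + 3 * (k + s) - (k * x + t)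
  regroup = solve-∀

cycleBound⇔reducedCost-nonneg : ∀ {m} (c f : Fin m → ℕ) C →
  Σlist (λ e → c e ℕ.* f e) C ℕ.≤ 3 ℕ.* Σlist c C ⇔ + 0 ℤ.≤ listSum (reducedCost c f) C
cycleBound⇔reducedCost-nonneg c f C = mk⇔
  (λ bound → subst (+ 0 ℤ.≤_) (sym (listSum-reducedCost c f C)) (ℤP.i≤j⇒0≤j-i (+≤+ bound)))
  (λ nonneg → ℤP.drop‿+≤+ (ℤP.0≤i-j⇒j≤i (subst (+ 0 ℤ.≤_) (listSum-reducedCost c f C) nonneg)))

module _ {n m : ℕ} (src tgt : Fin m → Fin n) (d : Orientation m) where

  private
    T H : Fin m → Fin n
    T = tailO src tgt d
    H = headO src tgt d

  flow-balanced : ∀ {f} → Conserves T H (λ e → + f e) → Balanced src tgt (extF d f)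
  flow-balanced {f} conserves v =
    trans (sym (excess-oriented src tgt d (λ e → + f e) v)) (conserves⇒balanced T H conserves v)

  balanced-flow : ∀ {f} → Balanced src tgt (extF d f) → Conserves T H (λ e → + f e)
  balanced-flow {f} balanced =
    balanced⇒conserves T H (λ v → trans (excess-oriented src tgt d (λ e → + f e) v) (balanced v))

  circulation-balanced : ∀ {g} → Conserves H T g → Balanced src tgt (extR d g)
  circulation-balanced {g} conserves v =
    trans (sym (excess-reversed src tgt d g v)) (conserves⇒balanced H T conserves v)

  balanced-circulation : ∀ {g} → Balanced src tgt (extR d g) → Conserves H T g
  balanced-circulation {g} balanced =
    balanced⇒conserves H T (λ v → trans (excess-reversed src tgt d g v) (balanced v))

module Reoriented {n m : ℕ} (src tgt : Fin m → Fin n) (c : Fin m → ℕ) (d : Orientation m) (f : Fin m → ℕ)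
                  (f≤6 : ∀ e → f e ℕ.≤ 6) (g : Fin m → ℤ) (d′ : Orientation m) (f′ : Fin m → ℕ)
                  (switched : ∀ e → Switch (d e) (f e) (g e) (d′ e) (f′ e))
                  (g-balanced : Balanced src tgt (extR d g)) where

  private
    T H T′ H′ : Fin m → Fin n
    T = tailO src tgt d
    H = headO src tgt d
    T′ = tailO src tgt d′
    H′ = headO src tgt d′

  module _ (h : Fin m → ℤ) (h-bits : ∀ e → Bit (h e)) where

    -- h − g, read along the orientation d′ of f + 6g.
    residualFlow : Fin m → ℕ
    residualFlow e = ∣ h e - g e ∣

    private
      excess-h≡-excess-residual : ∀ v → excess H T h v ≡ - excess T′ H′ (λ e → + residualFlow e) v
      excess-h≡-excess-residual v = begin
        excess H T h v
          ≡⟨ excess-reversed src tgt d h v ⟩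
        excess src tgt (extR d h) v
          ≡⟨ excess-cong src tgt (λ e → switch-residual (switched e) (h-bits e)) v ⟩
        excess src tgt (λ e → extR d g e - signed (d′ e) (+ residualFlow e)) v
          ≡⟨ excess-− src tgt (extR d g) (λ e → signed (d′ e) (+ residualFlow e)) v ⟩
        excess src tgt (extR d g) v - excess src tgt (λ e → signed (d′ e) (+ residualFlow e)) v
          ≡⟨ cong (_- excess src tgt (λ e → signed (d′ e) (+ residualFlow e)) v) (g-balanced v) ⟩
        + 0 - excess src tgt (λ e → signed (d′ e) (+ residualFlow e)) v
          ≡⟨ ℤP.+-identityˡ _ ⟩
        - excess src tgt (λ e → signed (d′ e) (+ residualFlow e)) v
          ≡⟨ cong -_ (excess-oriented src tgt d′ (λ e → + residualFlow e) v) ⟨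
        - excess T′ H′ (λ e → + residualFlow e) v ∎
        where open ≡-Reasoning

    circulation⇒residual-balanced : Conserves H T h → Balanced T′ H′ (λ e → + residualFlow e)
    circulation⇒residual-balanced conserves v = begin
      excess T′ H′ (λ e → + residualFlow e) v     ≡⟨ ℤP.neg-involutive _ ⟨
      - - excess T′ H′ (λ e → + residualFlow e) v ≡⟨ cong -_ (excess-h≡-excess-residual v) ⟨
      - excess H T h v                            ≡⟨ cong -_ (conserves⇒balanced H T conserves v) ⟩
      + 0                                         ∎
      where open ≡-Reasoning

    residual-balanced⇒circulation : Balanced T′ H′ (λ e → + residualFlow e) → Conserves H T h
    residual-balanced⇒circulation balanced =
      balanced⇒conserves H T (λ v → trans (excess-h≡-excess-residual v) (cong -_ (balanced v)))

    cost-difference : circCost c f h - circCost c f g ≡ sum (λ e → + residualFlow e * reducedCost c f′ e)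
    cost-difference = begin
      circCost c f h - circCost c f g
        ≡⟨ cong₂ _-_ (Σℤ≡sum (λ e → reducedCost c f e * h e)) (Σℤ≡sum (λ e → reducedCost c f e * g e)) ⟩
      sum (λ e → reducedCost c f e * h e) - sum (λ e → reducedCost c f e * g e)
        ≡⟨ ∑-distrib-− (λ e → reducedCost c f e * h e) (λ e → reducedCost c f e * g e) ⟨
      sum (λ e → reducedCost c f e * h e - reducedCost c f e * g e)
        ≡⟨ sum-cong-≗ (λ e → switch-cost (switched e) (f≤6 e) (h-bits e) (+ c e)) ⟩
      sum (λ e → + residualFlow e * reducedCost c f′ e) ∎
      where open ≡-Reasoning

  cycle-circulation : ∀ C → IsDirCycle T′ H′ C →
    ∃ λ h → IsCirculation src tgt d h × circCost c f h - circCost c f g ≡ listSum (reducedCost c f′) C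
  cycle-circulation C cycle = h , (h-range , h-conserves) , (begin
    circCost c f h - circCost c f g                        ≡⟨ cost-difference h h-bits ⟩
    sum (λ e → + residualFlow h h-bits e * reducedCost c f′ e)
      ≡⟨ sum-cong-≗ (λ e → cong (λ r → + r * reducedCost c f′ e) (residual≡multiplicity e)) ⟩
    sum (λ e → + multiplicity C e * reducedCost c f′ e)    ≡⟨ sum-multiplicity (reducedCost c f′) C ⟩
    listSum (reducedCost c f′) C                           ∎)
    where
    open ≡-Reasoning

    toggled : ∀ e → ∃ λ h → Bit h × ∣ h - g e ∣ ≡ multiplicity C e
    toggled e = toggle (switch-bit (switched e)) (unique⇒multiplicity≤1 (dirCycle⇒unique cycle) e)

    h : Fin m → ℤ
    h e = proj₁ (toggled e)

    h-bits : ∀ e → Bit (h e)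
    h-bits e = proj₁ (proj₂ (toggled e))

    residual≡multiplicity : ∀ e → residualFlow h h-bits e ≡ multiplicity C e
    residual≡multiplicity e = proj₂ (proj₂ (toggled e))

    h-range : ∀ e → + 0 ℤ.≤ h e × h e ℤ.≤ + 1
    h-range e = bit-range (h-bits e)

    h-conserves : Conserves H T h
    h-conserves = residual-balanced⇒circulation h h-bits λ v →
      trans (excess-cong T′ H′ (λ e → cong +_ (residual≡multiplicity e)) v) (cycle-balanced T′ H′ C cycle v)

  circulation-cost-increase : (∀ C → IsDirCycle T′ H′ C → + 0 ℤ.≤ listSum (reducedCost c f′) C) →
    ∀ h → IsCirculation src tgt d h → circCost c f g ℤ.≤ circCost c f h
  circulation-cost-increase cycles-nonneg h (h-range , h-conserves) = ℤP.0≤i-j⇒j≤i (begin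
    + 0                                                       ≤⟨ weight-nonneg ⟩
    sum (λ e → + residualFlow h h-bits e * reducedCost c f′ e) ≡⟨ cost-difference h h-bits ⟨
    circCost c f h - circCost c f g                           ∎)
    where
    open ℤP.≤-Reasoning
    h-bits : ∀ e → Bit (h e)
    h-bits e = bit (proj₁ (h-range e)) (proj₂ (h-range e))
    weight-nonneg = circulation-weight-nonneg T′ H′ (reducedCost c f′) cycles-nonneg (residualFlow h h-bits)
                      (circulation⇒residual-balanced h h-bits h-conserves)

module _ {n m : ℕ} (src tgt : Fin m → Fin n) (c : Fin m → ℕ) (d : Orientation m) (f : Fin m → ℕ)
         (nzFlow : IsNZFlow src tgt 6 d f) (g : Fin m → ℤ) where

  private
    f-range : ∀ e → 1 ℕ.≤ f e × f e ℕ.≤ 5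
    f-range = proj₁ nzFlow

    f≤6 : ∀ e → f e ℕ.≤ 6
    f≤6 e = ℕP.m≤n⇒m≤1+n (proj₂ (f-range e))

    f-balanced : Balanced src tgt (extF d f)
    f-balanced = flow-balanced src tgt d (proj₂ nzFlow)

  minCost⇒locallyOptimal : IsMinCostCirculation src tgt c d f g →
                           IsLocOptNZFlow src tgt c 6 (λ e → extF d f e + + 6 * extR d g e)
  minCost⇒locallyOptimal ((g-range , g-conserves) , minimal) =
    d′ , f′ , ((λ e → switch-range (switched e) (f-range e)) , f′-conserves) , flows , optimal
    where
    switched-g : ∀ e → ∃ λ b′ → ∃ λ x′ → Switch (d e) (f e) (g e) b′ x′
    switched-g e = switch (d e) (f e) (bit (proj₁ (g-range e)) (proj₂ (g-range e)))

    d′ : Orientation _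
    d′ e = proj₁ (switched-g e)

    f′ : Fin _ → ℕ
    f′ e = proj₁ (proj₂ (switched-g e))

    switched : ∀ e → Switch (d e) (f e) (g e) (d′ e) (f′ e)
    switched e = proj₂ (proj₂ (switched-g e))

    g-balanced : Balanced src tgt (extR d g)
    g-balanced = circulation-balanced src tgt d g-conserves

    open Reoriented src tgt c d f f≤6 g d′ f′ switched g-balanced

    flows : ∀ e → extF d′ f′ e ≡ extF d f e + + 6 * extR d g e
    flows e = switch-flow (switched e) (f≤6 e)

    f′-conserves : Conserves (tailO src tgt d′) (headO src tgt d′) (λ e → + f′ e)
    f′-conserves = balanced-flow src tgt d′ λ v → begin
      excess src tgt (extF d′ f′) v
        ≡⟨ excess-cong src tgt flows v ⟩
      excess src tgt (λ e → extF d f e + + 6 * extR d g e) v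
        ≡⟨ excess-+* src tgt (extF d f) (+ 6) (extR d g) v ⟩
      excess src tgt (extF d f) v + + 6 * excess src tgt (extR d g) v
        ≡⟨ cong₂ (λ p q → p + + 6 * q) (f-balanced v) (g-balanced v) ⟩
      + 0 ∎
      where open ≡-Reasoning

    optimal : LocallyOptimal src tgt c d′ f′
    optimal C cycle with h , circulation , cost-change ← cycle-circulation C cycle =
      Equivalence.from (cycleBound⇔reducedCost-nonneg c f′ C)
        (subst (+ 0 ℤ.≤_) cost-change (ℤP.i≤j⇒0≤j-i (minimal h circulation)))

  locallyOptimal⇒minCost : IsLocOptNZFlow src tgt c 6 (λ e → extF d f e + + 6 * extR d g e) →
                           IsMinCostCirculation src tgt c d f g
  locallyOptimal⇒minCost (d′ , f′ , (f′-range , f′-conserves) , flows , optimal) =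
    ((λ e → bit-range (switch-bit (switched e))) , balanced-circulation src tgt d g-balanced) ,
    circulation-cost-increase λ C cycle → Equivalence.to (cycleBound⇔reducedCost-nonneg c f′ C) (optimal C cycle)
    where
    switched : ∀ e → Switch (d e) (f e) (g e) (d′ e) (f′ e)
    switched e = classify (f-range e) (proj₂ (f′-range e)) (flows e)

    g-balanced : Balanced src tgt (extR d g)
    g-balanced v = ℤP.*-cancelˡ-≡ (+ 6) _ (+ 0) (begin
      + 6 * excess src tgt (extR d g) v                               ≡⟨ ℤP.+-identityˡ _ ⟨
      + 0 + + 6 * excess src tgt (extR d g) v                         ≡⟨ cong (_+ _) (f-balanced v) ⟨
      excess src tgt (extF d f) v + + 6 * excess src tgt (extR d g) v
        ≡⟨ excess-+* src tgt (extF d f) (+ 6) (extR d g) v ⟨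
      excess src tgt (λ e → extF d f e + + 6 * extR d g e) v          ≡⟨ excess-cong src tgt flows v ⟨
      excess src tgt (extF d′ f′) v                                   ≡⟨ flow-balanced src tgt d′ f′-conserves v ⟩
      + 0                                                             ≡⟨ ℤP.*-zeroʳ (+ 6) ⟨
      + 6 * + 0                                                       ∎)
      where open ≡-Reasoning

    open Reoriented src tgt c d f f≤6 g d′ f′ switched g-balanced

lemma6p4 : ∀ {n m : ℕ} (src tgt : Fin m → Fin n) (c : Fin m → ℕ)
             (d : Orientation m) (f : Fin m → ℕ) →
             IsNZFlow src tgt 6 d f →
             (g : Fin m → ℤ) →
             IsMinCostCirculation src tgt c d f g
               ⇔ IsLocOptNZFlow src tgt c 6 (λ e → extF d f e + + 6 * extR d g e)
lemma6p4 src tgt c d f nzFlow g =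
  mk⇔ (minCost⇒locallyOptimal src tgt c d f nzFlow g) (locallyOptimal⇒minCost src tgt c d f nzFlow g)
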